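{- Let $C$ be a positive integer and $n\geq 1$. Let $\Psi^{C}(p_1,\dots,p_n)$ be the propositional formula defined in the context. For any assignment $I:\{p_1,\dots,p_n\}\to\{0,1\}$ the following are equivalent: (a) $I$ can be extended to an assignment $I'$ of all propositions occurring in $\Psi^{C}(p_1,\dots,p_n)$ such that $I'$ satisfies $\Psi^{C}(p_1,\dots,p_n)$; (b) the $0/1$ sequence $I(p_1),\dots,I(p_n)$ is $C$-bounded.
   Context: A $0/1$ sequence $a_1,\dots,a_n$ is $C$-bounded if for every $1\le j\le n$ the absolute difference between the number of $1$s and the number of $0$s among $a_1,\dots,a_j$ is at most $C$ (equivalently, the $\pm1$ sequence $x_i=2a_i-1$ satisfies $|\sum_{i=1}^j x_i|\le C$ for all $j$). Let $p_1,\dots,p_n$ be propositional variables and let $s^k_j$, $0\le k\le n$, $0\le j\le n$, be further (auxiliary) propositional variables. Let $\Phi(p_1,\dots,p_n)$ be the conjunction of: $s^k_j\leftrightarrow\big(s^k_{j-1}\lor(s^{k-1}_{j-1}\land p_j)\big)$ for all $1\le k\le n$, $1\le j\le n$; $\lnot s^k_j$ for all $0\le j<k\le n$; and $s^0_j$ for all $0\le j\le n$. Let $\Psi^{C}(p_1,\dots,p_n)$ be the conjunction of $\Phi(p_1,\dots,p_n)$ with: $s^k_j$ for all $1\le k\le n$ and $2k-2+C<j\le n$; and $\lnot s^k_j$ for all $1\le k\le n$ and $0\le j<2k-C$. -}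

module Defs where

open import Data.Nat using (ℕ; zero; suc; _+_; _*_; _∸_; _≤_; _<_; _<?_)
open import Data.Bool using (Bool; true; false; _∧_; _∨_; not)
open import Data.Fin using (Fin; fromℕ<)
open import Data.Integer as ℤ using (ℤ; +_; -[1+_]; ∣_∣)
open import Data.List using (List; []; _∷_; map; upTo; concatMap)
open import Relation.Nullary using (yes; no)
open import Relation.Binary.PropositionalEquality using (_≡_)

-- The j-th element (1-based) a_j of a sequence a_1,…,a_n given as Fin n → Bool
-- (a_j = I(p_j)); out of range indices return false (never used).
at : ∀ {n} → (Fin n → Bool) → ℕ → Bool
at {n} a zero = false
at {n} a (suc j) with j <? n
... | yes j<n = a (fromℕ< j<n)
... | no _    = false

sign : Bool → ℤ
sign true  = + 1
sign false = -[1+ 0 ]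

prefix : ∀ {n} → (Fin n → Bool) → ℕ → ℤ
prefix a zero    = + 0
prefix a (suc j) = prefix a j ℤ.+ sign (at a (suc j))

CBounded : ℕ → ∀ {n} → (Fin n → Bool) → Set
CBounded C {n} a = ∀ j → 1 ≤ j → j ≤ n → ∣ prefix a j ∣ ≤ C

-- propositional variables: p j  (= p_j)  and  s k j  (= s^k_j)
data Var : Set where
  p : ℕ → Var
  s : ℕ → ℕ → Var

data Form : Set where
  var  : Var → Form
  ⊤f   : Form
  ¬f_  : Form → Form
  _∧f_ : Form → Form → Form
  _∨f_ : Form → Form → Form
  _↔f_ : Form → Form → Form

eval : (Var → Bool) → Form → Bool
eval I (var v)   = I v
eval I ⊤f        = true
eval I (¬f φ)    = not (eval I φ)
eval I (φ ∧f ψ)  = eval I φ ∧ eval I ψ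
eval I (φ ∨f ψ)  = eval I φ ∨ eval I ψ
eval I (φ ↔f ψ)  = iff (eval I φ) (eval I ψ)
  where
  iff : Bool → Bool → Bool
  iff true  b = b
  iff false b = not b

Satisfies : (Var → Bool) → Form → Set
Satisfies I φ = eval I φ ≡ true

⋀ : List Form → Form
⋀ []       = ⊤f
⋀ (φ ∷ φs) = φ ∧f ⋀ φs

-- inclusive range [lo .. hi]  (empty if hi < lo)
range : ℕ → ℕ → List ℕ
range lo hi = map (λ i → lo + i) (upTo (suc hi ∸ lo))

Φ : ℕ → Form
Φ n =
  ⋀ (concatMap (λ k → map (λ j →
        var (s k j) ↔f (var (s k (j ∸ 1)) ∨f (var (s (k ∸ 1) (j ∸ 1)) ∧f var (p j))))
       (range 1 n)) (range 1 n))
  ∧f (⋀ (concatMap (λ k → map (λ j → ¬f var (s k j)) (range 0 (k ∸ 1))) (range 1 n))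
  ∧f  ⋀ (map (λ j → var (s 0 j)) (range 0 n)))

-- Ψ^C(p_1,…,p_n)
--   s^k_j   for 1 ≤ k ≤ n, 2k-2+C < j ≤ n   (i.e. 2(k-1)+C+1 ≤ j ≤ n)
--   ¬ s^k_j for 1 ≤ k ≤ n, 0 ≤ j < 2k-C    (i.e. j ∈ [0, 2k ∸ C) )
Ψ : ℕ → ℕ → Form
Ψ C n =
  Φ n
  ∧f (⋀ (concatMap (λ k → map (λ j → var (s k j)) (range (suc (2 * (k ∸ 1) + C)) n)) (range 1 n))
  ∧f  ⋀ (concatMap (λ k → map (λ j → ¬f var (s k j)) (upTo (2 * k ∸ C))) (range 1 n)))

Extends : ∀ {n} → (Fin n → Bool) → (Var → Bool) → Set
Extends {n} I I' = ∀ j → 1 ≤ j → j ≤ n → I' (p j) ≡ at I j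

-- Read s^k_j as "at least k of a_1, …, a_j are 1".  The clauses of Φ are exactly the
-- recurrence, boundary and base conditions of this counter, so they determine every s^k_j
-- with j, k ≤ n.  With o ones and z zeros among the first j = o + z entries, the extra
-- clauses of Ψ^C then say that o ≥ k whenever j > 2(k − 1) + C, i.e. z ≤ o + C, and that
-- o < k whenever j < 2k − C, i.e. o ≤ z + C: together ∣o − z∣ ≤ C.
module Submission where

open import Defs
open import Data.Nat using (ℕ; _≤_)
open import Data.Bool using (Bool)
open import Data.Fin using (Fin)
open import Data.Product using (Σ; _×_)
open import Function.Bundles using (_⇔_)

open import Data.Bool using (true; false; _∧_; _∨_; if_then_else_)
open import Data.Bool.Properties using (∨-zeroʳ; ∨-identityʳ; ∧-zeroʳ; ∧-identityʳ; T-≡; ¬-not)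
open import Data.Empty using (⊥-elim)
open import Data.Integer as ℤ using (_⊖_; ∣_∣)
import Data.Integer.Properties as ℤ
open import Data.List using (List; []; _∷_; map; upTo; concatMap)
open import Data.List.Membership.Propositional using (_∈_; find; lose)
open import Data.List.Membership.Propositional.Properties
  using (∈-map⁺; ∈-map⁻; ∈-concatMap⁺; ∈-concatMap⁻; ∈-upTo⁺; ∈-upTo⁻)
open import Data.List.Relation.Unary.Any using (here; there)
open import Data.Nat
  using (zero; suc; _+_; _*_; _∸_; _<_; _≤ᵇ_; z≤n; s≤s; s≤s⁻¹; _≤?_; _<?_)
open import Data.Nat.Properties
open import Data.Product using (_,_; proj₁; proj₂; ∃)
open import Data.Sum using (inj₁; inj₂)
open import Function.Bundles using (mk⇔; Equivalence)
open import Function.Properties.Equivalence using () renaming (refl to ⇔-refl; trans to ⇔-trans)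
open import Data.Product.Function.NonDependent.Propositional using (_×-⇔_)
open import Relation.Binary.PropositionalEquality
open import Relation.Nullary using (¬_; yes; no)

open Equivalence using (to; from)

satisfies-∧ : ∀ I φ ψ → Satisfies I (φ ∧f ψ) ⇔ (Satisfies I φ × Satisfies I ψ)
satisfies-∧ I φ ψ = mk⇔ split join
  where
  split : Satisfies I (φ ∧f ψ) → Satisfies I φ × Satisfies I ψ
  split sat with eval I φ | eval I ψ
  split refl | true | true = refl , refl
  join : Satisfies I φ × Satisfies I ψ → Satisfies I (φ ∧f ψ)
  join (sat-φ , sat-ψ) rewrite sat-φ | sat-ψ = refl

satisfies-↔ : ∀ I φ ψ → Satisfies I (φ ↔f ψ) ⇔ (eval I φ ≡ eval I ψ)
satisfies-↔ I φ ψ with eval I φ | eval I ψ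
... | true  | true  = mk⇔ (λ _ → refl) (λ _ → refl)
... | true  | false = mk⇔ (λ ()) (λ ())
... | false | true  = mk⇔ (λ ()) (λ ())
... | false | false = mk⇔ (λ _ → refl) (λ _ → refl)

satisfies-⋀ : ∀ {I} φs → Satisfies I (⋀ φs) ⇔ (∀ {φ} → φ ∈ φs → Satisfies I φ)
satisfies-⋀ {I} φs = mk⇔ (split φs) (join φs)
  where
  split : ∀ φs → Satisfies I (⋀ φs) → ∀ {φ} → φ ∈ φs → Satisfies I φ
  split (φ ∷ φs) sat (here refl) = proj₁ (to (satisfies-∧ I φ (⋀ φs)) sat)
  split (φ ∷ φs) sat (there φ∈φs) = split φs (proj₂ (to (satisfies-∧ I φ (⋀ φs)) sat)) φ∈φs
  join : ∀ φs → (∀ {φ} → φ ∈ φs → Satisfies I φ) → Satisfies I (⋀ φs)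
  join [] _ = refl
  join (φ ∷ φs) sat =
    from (satisfies-∧ I φ (⋀ φs)) (sat (here refl) , join φs (λ φ∈ → sat (there φ∈)))

satisfies-⋀-map : ∀ {I} (g : ℕ → Form) xs →
  Satisfies I (⋀ (map g xs)) ⇔ (∀ {x} → x ∈ xs → Satisfies I (g x))
satisfies-⋀-map {I} g xs = mk⇔ split join
  where
  split : Satisfies I (⋀ (map g xs)) → ∀ {x} → x ∈ xs → Satisfies I (g x)
  split sat x∈xs = to (satisfies-⋀ (map g xs)) sat (∈-map⁺ g x∈xs)
  join : (∀ {x} → x ∈ xs → Satisfies I (g x)) → Satisfies I (⋀ (map g xs))
  join sat = from (satisfies-⋀ (map g xs)) λ φ∈ → member (∈-map⁻ g φ∈)
    where
    member : ∀ {φ} → ∃ (λ x → x ∈ xs × φ ≡ g x) → Satisfies I φ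
    member (x , x∈xs , refl) = sat x∈xs

satisfies-⋀-concatMap : ∀ {I} (g : ℕ → ℕ → Form) (R : ℕ → List ℕ) K →
  Satisfies I (⋀ (concatMap (λ k → map (g k) (R k)) K)) ⇔
  (∀ {k j} → k ∈ K → j ∈ R k → Satisfies I (g k j))
satisfies-⋀-concatMap {I} g R K = mk⇔ split join
  where
  f = λ k → map (g k) (R k)
  split : Satisfies I (⋀ (concatMap f K)) → ∀ {k j} → k ∈ K → j ∈ R k → Satisfies I (g k j)
  split sat k∈K j∈R =
    to (satisfies-⋀ (concatMap f K)) sat (∈-concatMap⁺ f (lose k∈K (∈-map⁺ (g _) j∈R)))
  join : (∀ {k j} → k ∈ K → j ∈ R k → Satisfies I (g k j)) → Satisfies I (⋀ (concatMap f K))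
  join sat = from (satisfies-⋀ (concatMap f K)) λ φ∈ →
    member (find (∈-concatMap⁻ f {xs = K} φ∈))
    where
    member : ∀ {φ} → ∃ (λ k → k ∈ K × φ ∈ f k) → Satisfies I φ
    member (k , k∈K , φ∈) with ∈-map⁻ (g k) φ∈
    ... | j , j∈R , refl = sat k∈K j∈R

∈-range⇔ : ∀ {lo hi j} → j ∈ range lo hi ⇔ (lo ≤ j × j ≤ hi)
∈-range⇔ {lo} {hi} {j} = mk⇔ bounds member
  where
  bounds : j ∈ range lo hi → lo ≤ j × j ≤ hi
  bounds j∈ with ∈-map⁻ (lo +_) j∈
  ... | i , i∈ , refl = m≤m+n lo i , s≤s⁻¹ (subst (_≤ suc hi) (cong suc (+-comm i lo))
                          (m≤o∸n⇒m+n≤o (suc i) lo≤1+hi i<))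
    where
    i< = ∈-upTo⁻ i∈
    lo≤1+hi : lo ≤ suc hi
    lo≤1+hi = <⇒≤ (m∸n≢0⇒n<m (λ eq → n≮0 (subst (i <_) eq i<)))
  member : lo ≤ j × j ≤ hi → j ∈ range lo hi
  member (lo≤j , j≤hi) = subst (_∈ range lo hi) (m+[n∸m]≡n lo≤j)
    (∈-map⁺ (lo +_) (∈-upTo⁺ (∸-monoˡ-< (s≤s j≤hi) lo≤j)))

≤ᵇ-true : ∀ {m n} → m ≤ n → (m ≤ᵇ n) ≡ true
≤ᵇ-true m≤n = to T-≡ (≤⇒≤ᵇ m≤n)

≤ᵇ-false : ∀ {m n} → n < m → (m ≤ᵇ n) ≡ false
≤ᵇ-false {m} {n} n<m = ¬-not λ eq → <⇒≱ n<m (≤ᵇ⇒≤ m n (from T-≡ eq))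

1+m≤ᵇ1+n : ∀ m n → (suc m ≤ᵇ suc n) ≡ (m ≤ᵇ n)
1+m≤ᵇ1+n zero    n = refl
1+m≤ᵇ1+n (suc m) n = refl

1+m≤ᵇn∨m≤ᵇn : ∀ m n → (suc m ≤ᵇ n) ∨ (m ≤ᵇ n) ≡ (m ≤ᵇ n)
1+m≤ᵇn∨m≤ᵇn zero    n       = ∨-zeroʳ _
1+m≤ᵇn∨m≤ᵇn (suc m) zero    = refl
1+m≤ᵇn∨m≤ᵇn (suc m) (suc n) rewrite 1+m≤ᵇ1+n m n = 1+m≤ᵇn∨m≤ᵇn m n

-- The recurrence clause of Φ, for the counter: at least k + 1 ones among j + 1 entries iff
-- already among the first j, or at least k there and the next entry is 1.
≤ᵇ-counter-step : ∀ b k c → (suc k ≤ᵇ (if b then suc c else c)) ≡ (suc k ≤ᵇ c) ∨ ((k ≤ᵇ c) ∧ b)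
≤ᵇ-counter-step false k c = sym (trans (cong ((suc k ≤ᵇ c) ∨_) (∧-zeroʳ _)) (∨-identityʳ _))
≤ᵇ-counter-step true  k c = begin
  (suc k ≤ᵇ suc c)                   ≡⟨ 1+m≤ᵇ1+n k c ⟩
  (k ≤ᵇ c)                           ≡⟨ 1+m≤ᵇn∨m≤ᵇn k c ⟨
  (suc k ≤ᵇ c) ∨ (k ≤ᵇ c)            ≡⟨ cong ((suc k ≤ᵇ c) ∨_) (∧-identityʳ _) ⟨
  (suc k ≤ᵇ c) ∨ ((k ≤ᵇ c) ∧ true)   ∎
  where open ≡-Reasoning

module _ {n : ℕ} (a : Fin n → Bool) where

  ones zeros : ℕ → ℕ
  ones zero    = 0
  ones (suc j) = if at a (suc j) then suc (ones j) else ones j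
  zeros zero    = 0
  zeros (suc j) = if at a (suc j) then zeros j else suc (zeros j)

  ones+zeros≡ : ∀ j → ones j + zeros j ≡ j
  ones+zeros≡ zero = refl
  ones+zeros≡ (suc j) with at a (suc j)
  ... | true  = cong suc (ones+zeros≡ j)
  ... | false = trans (+-suc (ones j) (zeros j)) (cong suc (ones+zeros≡ j))

  ones≤ : ∀ j → ones j ≤ j
  ones≤ j = subst (ones j ≤_) (ones+zeros≡ j) (m≤m+n (ones j) (zeros j))

  prefix≡ones⊖zeros : ∀ j → prefix a j ≡ ones j ⊖ zeros j
  prefix≡ones⊖zeros zero = refl
  prefix≡ones⊖zeros (suc j) with at a (suc j)
  ... | true  = trans (cong (ℤ._+ ℤ.+ 1) (prefix≡ones⊖zeros j))
                (trans (ℤ.distribˡ-⊖-+-pos 1 (ones j) (zeros j))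
                       (cong (_⊖ zeros j) (+-comm (ones j) 1)))
  ... | false = trans (cong (ℤ._+ ℤ.-[1+ 0 ]) (prefix≡ones⊖zeros j))
                (trans (ℤ.distribˡ-⊖-+-neg 0 (ones j) (zeros j))
                       (cong (λ z → ones j ⊖ suc z) (+-identityʳ (zeros j))))

  ones-beyond : ∀ j → n ≤ j → ones j ≡ ones n
  ones-beyond zero    z≤n = refl
  ones-beyond (suc j) n≤1+j with m≤n⇒m<n∨m≡n n≤1+j
  ... | inj₂ refl = refl
  ... | inj₁ n<1+j with j <? n
  ...   | yes j<n = ⊥-elim (<⇒≱ j<n (s≤s⁻¹ n<1+j))
  ...   | no _    = ones-beyond j (s≤s⁻¹ n<1+j)

  countingAssignment : Var → Bool
  countingAssignment (p j)   = at a j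
  countingAssignment (s k j) = k ≤ᵇ ones j

∣m⊖n∣≤c⇔ : ∀ m n c → ∣ m ⊖ n ∣ ≤ c ⇔ (m ≤ n + c × n ≤ m + c)
∣m⊖n∣≤c⇔ m n c with ≤-total m n
... | inj₁ m≤n rewrite ℤ.∣⊖∣-≤ m≤n = mk⇔
  (λ n∸m≤c → ≤-trans m≤n (m≤m+n n c) , ≤-trans (m≤n+m∸n n m) (+-monoʳ-≤ m n∸m≤c))
  (λ (_ , n≤m+c) → m≤n+o⇒m∸n≤o n m n≤m+c)
... | inj₂ n≤m rewrite ℤ.∣m⊖n∣≡∣n⊖m∣ m n | ℤ.∣⊖∣-≤ n≤m = mk⇔
  (λ m∸n≤c → ≤-trans (m≤n+m∸n m n) (+-monoʳ-≤ n m∸n≤c) , ≤-trans n≤m (m≤m+n m c))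
  (λ (m≤n+c , _) → m≤n+o⇒m∸n≤o m n m≤n+c)

CBounded⇔ones-zeros-close : ∀ C {n} (a : Fin n → Bool) → CBounded C a ⇔
  (∀ j → j ≤ n → ones a j ≤ zeros a j + C × zeros a j ≤ ones a j + C)
CBounded⇔ones-zeros-close C a = mk⇔ close bounded
  where
  close : CBounded C a → ∀ j → _ → ones a j ≤ zeros a j + C × zeros a j ≤ ones a j + C
  close _ zero _ = z≤n , z≤n
  close bnd (suc j) 1+j≤n = to (∣m⊖n∣≤c⇔ _ _ C)
    (subst (λ x → ∣ x ∣ ≤ C) (prefix≡ones⊖zeros a (suc j)) (bnd (suc j) (s≤s z≤n) 1+j≤n))
  bounded : (∀ j → j ≤ _ → ones a j ≤ zeros a j + C × zeros a j ≤ ones a j + C) → CBounded C a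
  bounded close j _ j≤n = subst (λ x → ∣ x ∣ ≤ C) (sym (prefix≡ones⊖zeros a j))
    (from (∣m⊖n∣≤c⇔ _ _ C) (close j j≤n))

2m+c≡m+[m+c] : ∀ m c → 2 * m + c ≡ m + (m + c)
2m+c≡m+[m+c] m c = trans (cong (λ x → m + x + c) (+-identityʳ m)) (+-assoc m m c)

n≤m+c⇒2k+c<m+n⇒k<m : ∀ {m n c k} → n ≤ m + c → 2 * k + c < m + n → k < m
n≤m+c⇒2k+c<m+n⇒k<m {m} {n} {c} {k} n≤m+c 2k+c<m+n =
  *-cancelˡ-< 2 k m (+-cancelʳ-< c (2 * k) (2 * m) (begin-strict
    2 * k + c     <⟨ 2k+c<m+n ⟩
    m + n         ≤⟨ +-monoʳ-≤ m n≤m+c ⟩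
    m + (m + c)   ≡⟨ 2m+c≡m+[m+c] m c ⟨
    2 * m + c     ∎))
  where open ≤-Reasoning

m+c<n⇒2m+c<m+n : ∀ {m n c} → m + c < n → 2 * m + c < m + n
m+c<n⇒2m+c<m+n {m} {n} {c} m+c<n = begin-strict
  2 * m + c     ≡⟨ 2m+c≡m+[m+c] m c ⟩
  m + (m + c)   <⟨ +-monoʳ-< m m+c<n ⟩
  m + n         ∎
  where open ≤-Reasoning

m≤n+c⇒m+n<2k∸c⇒m<k : ∀ {m n c k} → m ≤ n + c → m + n < 2 * k ∸ c → m < k
m≤n+c⇒m+n<2k∸c⇒m<k {m} {n} {c} {k} m≤n+c m+n<2k∸c = ≰⇒> λ k≤m →
  <⇒≱ m+n<2k∸c (m≤n+o⇒m∸n≤o (2 * k) c (begin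
    2 * k         ≤⟨ *-monoʳ-≤ 2 k≤m ⟩
    2 * m         ≡⟨ cong (m +_) (+-identityʳ m) ⟩
    m + m         ≤⟨ +-monoʳ-≤ m m≤n+c ⟩
    m + (n + c)   ≡⟨ +-assoc m n c ⟨
    m + n + c     ≡⟨ +-comm (m + n) c ⟩
    c + (m + n)   ∎))
  where open ≤-Reasoning

n+c<m⇒m+n<2m∸c : ∀ {m n c} → n + c < m → m + n < 2 * m ∸ c
n+c<m⇒m+n<2m∸c {m} {n} {c} n+c<m = m+n≤o⇒m≤o∸n (suc (m + n)) (begin
  suc (m + n) + c   ≡⟨ cong suc (+-assoc m n c) ⟩
  suc (m + (n + c)) ≡⟨ +-suc m (n + c) ⟨
  m + suc (n + c)   ≤⟨ +-monoʳ-≤ m n+c<m ⟩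
  m + m             ≡⟨ cong (m +_) (+-identityʳ m) ⟨
  2 * m             ∎)
  where open ≤-Reasoning

recurrenceClause : ℕ → ℕ → Form
recurrenceClause k j =
  var (s k j) ↔f (var (s k (j ∸ 1)) ∨f (var (s (k ∸ 1) (j ∸ 1)) ∧f var (p j)))

sAtom ¬sAtom : ℕ → ℕ → Form
sAtom  k j = var (s k j)
¬sAtom k j = ¬f var (s k j)

satisfies-recurrenceClause : ∀ I k j → Satisfies I (recurrenceClause k j) ⇔
  (I (s k j) ≡ I (s k (j ∸ 1)) ∨ (I (s (k ∸ 1) (j ∸ 1)) ∧ I (p j)))
satisfies-recurrenceClause I k j =
  satisfies-↔ I (var (s k j)) (var (s k (j ∸ 1)) ∨f (var (s (k ∸ 1) (j ∸ 1)) ∧f var (p j)))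

satisfies-¬sAtom : ∀ I k j → Satisfies I (¬sAtom k j) ⇔ (I (s k j) ≡ false)
satisfies-¬sAtom I k j with I (s k j)
... | true  = mk⇔ (λ ()) (λ ())
... | false = mk⇔ (λ _ → refl) (λ _ → refl)

satisfies-Φ : ∀ I n → Satisfies I (Φ n) ⇔
  ( (∀ {k j} → k ∈ range 1 n → j ∈ range 1 n → Satisfies I (recurrenceClause k j))
  × (∀ {k j} → k ∈ range 1 n → j ∈ range 0 (k ∸ 1) → Satisfies I (¬sAtom k j))
  × (∀ {j} → j ∈ range 0 n → Satisfies I (sAtom 0 j)))
satisfies-Φ I n =
  ⇔-trans (satisfies-∧ I recurrences (belowDiagonal ∧f base))
    (satisfies-⋀-concatMap recurrenceClause (λ _ → range 1 n) (range 1 n)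
     ×-⇔ ⇔-trans (satisfies-∧ I belowDiagonal base)
           (satisfies-⋀-concatMap ¬sAtom (λ k → range 0 (k ∸ 1)) (range 1 n)
            ×-⇔ satisfies-⋀-map (sAtom 0) (range 0 n)))
  where
  recurrences belowDiagonal base : Form
  recurrences   = ⋀ (concatMap (λ k → map (recurrenceClause k) (range 1 n)) (range 1 n))
  belowDiagonal = ⋀ (concatMap (λ k → map (¬sAtom k) (range 0 (k ∸ 1))) (range 1 n))
  base          = ⋀ (map (sAtom 0) (range 0 n))

satisfies-Ψ : ∀ I C n → Satisfies I (Ψ C n) ⇔
  ( Satisfies I (Φ n)
  × (∀ {k j} → k ∈ range 1 n → j ∈ range (suc (2 * (k ∸ 1) + C)) n → Satisfies I (sAtom k j))
  × (∀ {k j} → k ∈ range 1 n → j ∈ upTo (2 * k ∸ C) → Satisfies I (¬sAtom k j)))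
satisfies-Ψ I C n =
  ⇔-trans (satisfies-∧ I (Φ n) (atLeast ∧f atMost))
    (⇔-refl
     ×-⇔ ⇔-trans (satisfies-∧ I atLeast atMost)
           (satisfies-⋀-concatMap sAtom (λ k → range (suc (2 * (k ∸ 1) + C)) n) (range 1 n)
            ×-⇔ satisfies-⋀-concatMap ¬sAtom (λ k → upTo (2 * k ∸ C)) (range 1 n)))
  where
  atLeast atMost : Form
  atLeast = ⋀ (concatMap (λ k → map (sAtom k) (range (suc (2 * (k ∸ 1) + C)) n)) (range 1 n))
  atMost  = ⋀ (concatMap (λ k → map (¬sAtom k) (upTo (2 * k ∸ C))) (range 1 n))

counting-satisfies-Φ : ∀ {n} (a : Fin n → Bool) → Satisfies (countingAssignment a) (Φ n)
counting-satisfies-Φ {n} a = from (satisfies-Φ (countingAssignment a) n)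
  ( (λ k∈ j∈ → recurrence (proj₁ (to ∈-range⇔ k∈)) (proj₁ (to ∈-range⇔ j∈)))
  , (λ {k} k∈ j∈ →
       belowDiagonal (proj₁ (to ∈-range⇔ k∈)) (proj₂ (to (∈-range⇔ {0} {k ∸ 1}) j∈)))
  , (λ _ → refl))
  where
  recurrence : ∀ {k j} → 1 ≤ k → 1 ≤ j →
               Satisfies (countingAssignment a) (recurrenceClause k j)
  recurrence {suc k} {suc j} _ _ =
    from (satisfies-recurrenceClause (countingAssignment a) (suc k) (suc j))
      (≤ᵇ-counter-step (at a (suc j)) k (ones a j))
  belowDiagonal : ∀ {k j} → 1 ≤ k → j ≤ k ∸ 1 → Satisfies (countingAssignment a) (¬sAtom k j)
  belowDiagonal {suc k} {j} _ j≤k = from (satisfies-¬sAtom (countingAssignment a) (suc k) j)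
    (≤ᵇ-false (s≤s (≤-trans (ones≤ a j) j≤k)))

Φ-forces-counting : ∀ {n} {a : Fin n → Bool} {I} → Extends a I → Satisfies I (Φ n) →
  ∀ {j k} → j ≤ n → k ≤ n → I (s k j) ≡ countingAssignment a (s k j)
Φ-forces-counting {n} {a} {I} extends sat = forced
  where
  recurrence = proj₁ (to (satisfies-Φ I n) sat)
  belowDiagonal = proj₁ (proj₂ (to (satisfies-Φ I n) sat))
  base = proj₂ (proj₂ (to (satisfies-Φ I n) sat))
  forced : ∀ {j k} → j ≤ n → k ≤ n → I (s k j) ≡ countingAssignment a (s k j)
  forced {j} {zero} j≤n _ = base (from ∈-range⇔ (z≤n , j≤n))
  forced {zero} {suc k} _ 1+k≤n =
    to (satisfies-¬sAtom I (suc k) 0)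
      (belowDiagonal (from ∈-range⇔ (s≤s z≤n , 1+k≤n)) (from (∈-range⇔ {0} {k}) (z≤n , z≤n)))
  forced {suc j} {suc k} 1+j≤n 1+k≤n = begin
    I (s (suc k) (suc j))
      ≡⟨ to (satisfies-recurrenceClause I (suc k) (suc j))
            (recurrence (from ∈-range⇔ (s≤s z≤n , 1+k≤n)) (from ∈-range⇔ (s≤s z≤n , 1+j≤n))) ⟩
    I (s (suc k) j) ∨ (I (s k j) ∧ I (p (suc j)))
      ≡⟨ cong₂ (λ x y → x ∨ (y ∧ I (p (suc j)))) (forced j≤n 1+k≤n) (forced j≤n k≤n) ⟩
    (suc k ≤ᵇ c) ∨ ((k ≤ᵇ c) ∧ I (p (suc j)))
      ≡⟨ cong (λ x → (suc k ≤ᵇ c) ∨ ((k ≤ᵇ c) ∧ x)) (extends (suc j) (s≤s z≤n) 1+j≤n) ⟩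
    (suc k ≤ᵇ c) ∨ ((k ≤ᵇ c) ∧ at a (suc j))
      ≡⟨ ≤ᵇ-counter-step (at a (suc j)) k c ⟨
    countingAssignment a (s (suc k) (suc j))
      ∎
    where
    open ≡-Reasoning
    c = ones a j
    j≤n = ≤-trans (n≤1+n j) 1+j≤n
    k≤n = ≤-trans (n≤1+n k) 1+k≤n

Ψ-satisfied⇒CBounded : ∀ C {n} (a : Fin n → Bool) {I} → Extends a I →
  Satisfies I (Ψ C n) → CBounded C a
Ψ-satisfied⇒CBounded C {n} a {I} extends sat =
  from (CBounded⇔ones-zeros-close C a) λ j j≤n → ones≤zeros+C j≤n , zeros≤ones+C j≤n
  where
  forced = Φ-forces-counting extends (proj₁ (to (satisfies-Ψ I C n) sat))
  atLeast = proj₁ (proj₂ (to (satisfies-Ψ I C n) sat))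
  atMost = proj₂ (proj₂ (to (satisfies-Ψ I C n) sat))
  true≢false : true ≢ false
  true≢false ()
  ones≤zeros+C : ∀ {j} → j ≤ n → ones a j ≤ zeros a j + C
  ones≤zeros+C {j} j≤n = ≮⇒≥ refute
    where
    o = ones a j
    o≤n = ≤-trans (ones≤ a j) j≤n
    refute : ¬ (zeros a j + C < o)
    refute zeros+C<o = true≢false (begin
      true        ≡⟨ ≤ᵇ-true (≤-refl {o}) ⟨
      (o ≤ᵇ o)    ≡⟨ forced j≤n o≤n ⟨
      I (s o j)   ≡⟨ to (satisfies-¬sAtom I o j)
                       (atMost (from ∈-range⇔ (1≤o , o≤n)) (∈-upTo⁺ j<2o∸C)) ⟩
      false       ∎)
      where
      open ≡-Reasoning
      1≤o = ≤-trans (s≤s z≤n) zeros+C<o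
      j<2o∸C = subst (_< 2 * o ∸ C) (ones+zeros≡ a j) (n+c<m⇒m+n<2m∸c zeros+C<o)
  zeros≤ones+C : ∀ {j} → j ≤ n → zeros a j ≤ ones a j + C
  zeros≤ones+C {j} j≤n = ≮⇒≥ refute
    where
    o = ones a j
    refute : ¬ (o + C < zeros a j)
    refute o+C<zeros = true≢false (begin
      true              ≡⟨ atLeast (from ∈-range⇔ (s≤s z≤n , 1+o≤n))
                                   (from ∈-range⇔ (2o+C<j , j≤n)) ⟨
      I (s (suc o) j)   ≡⟨ forced j≤n 1+o≤n ⟩
      (suc o ≤ᵇ o)      ≡⟨ ≤ᵇ-false (≤-refl {suc o}) ⟩
      false             ∎)
      where
      open ≡-Reasoning
      2o+C<j = subst (2 * o + C <_) (ones+zeros≡ a j) (m+c<n⇒2m+c<m+n o+C<zeros)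
      o≤2o+C = ≤-trans (m≤m+n o (o + 0)) (m≤m+n (2 * o) C)
      1+o≤n = ≤-trans (s≤s o≤2o+C) (≤-trans 2o+C<j j≤n)

CBounded⇒counting-satisfies-Ψ : ∀ C {n} (a : Fin n → Bool) → CBounded C a →
  Satisfies (countingAssignment a) (Ψ C n)
CBounded⇒counting-satisfies-Ψ C {n} a bounded = from (satisfies-Ψ (countingAssignment a) C n)
  ( counting-satisfies-Φ a
  , (λ k∈ j∈ → atLeast (proj₁ (to ∈-range⇔ k∈)) (to ∈-range⇔ j∈))
  , (λ {k} {j} _ j∈ → from (satisfies-¬sAtom (countingAssignment a) k j)
                          (≤ᵇ-false (atMost k j (∈-upTo⁻ j∈)))))
  where
  close = to (CBounded⇔ones-zeros-close C a) bounded
  atLeast : ∀ {k j} → 1 ≤ k → suc (2 * (k ∸ 1) + C) ≤ j × j ≤ n →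
            Satisfies (countingAssignment a) (sAtom k j)
  atLeast {suc k} {j} _ (2k+C<j , j≤n) = ≤ᵇ-true (n≤m+c⇒2k+c<m+n⇒k<m (proj₂ (close j j≤n))
    (subst (2 * k + C <_) (sym (ones+zeros≡ a j)) 2k+C<j))
  -- The range 0 ≤ j < 2k − C may reach past n, where Φ says nothing about s^k_j and
  -- the counter has stopped at ones a n.
  atMost : ∀ k j → j < 2 * k ∸ C → ones a j < k
  atMost k j j<2k∸C with j ≤? n
  ... | yes j≤n = m≤n+c⇒m+n<2k∸c⇒m<k (proj₁ (close j j≤n))
                    (subst (_< 2 * k ∸ C) (sym (ones+zeros≡ a j)) j<2k∸C)
  ... | no  j≰n = subst (_< k) (sym (ones-beyond a j (<⇒≤ (≰⇒> j≰n))))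
                    (m≤n+c⇒m+n<2k∸c⇒m<k (proj₁ (close n ≤-refl))
                      (subst (_< 2 * k ∸ C) (sym (ones+zeros≡ a n)) (<-trans (≰⇒> j≰n) j<2k∸C)))

theorem1 : (C : ℕ) → 1 ≤ C → (n : ℕ) → 1 ≤ n → (I : Fin n → Bool) →
    (Σ (Var → Bool) (λ I' → Extends I I' × Satisfies I' (Ψ C n))) ⇔ CBounded C I
theorem1 C _ n _ I = mk⇔
  (λ (I' , extends , sat) → Ψ-satisfied⇒CBounded C I extends sat)
  (λ bounded → countingAssignment I , (λ _ _ _ → refl) , CBounded⇒counting-satisfies-Ψ C I bounded)
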